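{- Let $K,L\leq \mathrm{Aut}(Q_n)$ with $d_K\geq 5$. Then $(Q_n)_K$ and $(Q_n)_L$ are isomorphic if and only if $K$ and $L$ are conjugate in $\mathrm{Aut}(Q_n)$. In particular, $\mathrm{Aut}((Q_n)_K)=N_{\mathrm{Aut}(Q_n)}(K)/K$, where $N_{\mathrm{Aut}(Q_n)}(K)$ acts on the vertices of $(Q_n)_K$ by $(x^K)^g:=(x^g)^K$.
   Context: The $n$-cube $Q_n$ has vertex set $\mathbb{F}_2^n$, two vectors adjacent iff their Hamming distance is $1$; $\mathrm{Aut}(Q_n)=\mathbb{F}_2^n: S_n$ (translations and coordinate permutations), acting on the right. For $K\leq\mathrm{Aut}(Q_n)$, $d_K:=\min\{d_{Q_n}(x,x^k): x\in\mathbb{F}_2^n,\ 1\neq k\in K\}$ if $K\neq 1$ and $d_K:=\infty$ if $K=1$. The normal quotient $(Q_n)_K$ is the simple graph whose vertices are the $K$-orbits $x^K$ on $\mathbb{F}_2^n$, distinct orbits adjacent iff some vertex of one is adjacent in $Q_n$ to some vertex of the other. -}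

module Defs where

open import Data.Nat using (ℕ; zero; suc; _+_; _≤_)
open import Data.Bool using (Bool; true; false; _xor_; if_then_else_)
open import Data.Fin using (Fin)
open import Data.Vec using (Vec; lookup; tabulate; zipWith; replicate; foldr)
open import Data.Fin.Permutation using (Permutation′; _⟨$⟩ʳ_; _⟨$⟩ˡ_; _∘ₚ_; flip; id)
  renaming (_≈_ to _≈ₚ_)
open import Data.Product using (Σ; _×_; _,_; ∃; proj₁; proj₂)
open import Relation.Binary.PropositionalEquality using (_≡_)
open import Relation.Nullary using (¬_)
open import Level using (Level; suc) renaming (zero to lzero)

-- Vertices of Q_n : F_2^n, as Boolean vectors (xor = addition in F_2)
V : ℕ → Set
V n = Vec Bool n

_⊕_ : ∀ {n} → V n → V n → V n
_⊕_ = zipWith _xor_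

dist : ∀ {n} → V n → V n → ℕ
dist x y = foldr (λ _ → ℕ) (λ b k → (if b then 1 else 0) + k) 0 (x ⊕ y)

Adj : ∀ {n} → V n → V n → Set
Adj x y = dist x y ≡ 1

-- coordinate permutation acting on the right:  (x^σ)_{iσ} = x_i
permute : ∀ {n} → Permutation′ n → V n → V n
permute σ x = tabulate (λ j → lookup x (σ ⟨$⟩ˡ j))

-- Aut(Q_n) = F_2^n : S_n ; an element (σ , t) acts by  x ↦ x^σ + t
Aut : ℕ → Set
Aut n = Permutation′ n × V n

act : ∀ {n} → Aut n → V n → V n
act (σ , t) x = permute σ x ⊕ t

-- group structure (right action: x^(g·h) = (x^g)^h)
e : ∀ {n} → Aut n
e {n} = (id , replicate n false)

_·_ : ∀ {n} → Aut n → Aut n → Aut n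
(σ , t) · (τ , u) = (σ ∘ₚ τ , permute τ t ⊕ u)

_⁻¹ : ∀ {n} → Aut n → Aut n
(σ , t) ⁻¹ = (flip σ , permute (flip σ) t)

_≈_ : ∀ {n} → Aut n → Aut n → Set
(σ , t) ≈ (τ , u) = (σ ≈ₚ τ) × (t ≡ u)

record Subgroup (n : ℕ) : Set₁ where
  field
    Mem     : Aut n → Set
    ∈-resp  : ∀ {g h} → g ≈ h → Mem g → Mem h
    e-∈     : Mem e
    ·-∈     : ∀ {g h} → Mem g → Mem h → Mem (g · h)
    ⁻¹-∈    : ∀ {g} → Mem g → Mem (g ⁻¹)
open Subgroup public

_∈_ : ∀ {n} → Aut n → Subgroup n → Set
g ∈ K = Mem K g
infix 4 _∈_

-- d_K ≥ m  (vacuous when K = 1, matching d_K = ∞)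
dK≥ : ∀ {n} → Subgroup n → ℕ → Set
dK≥ K m = ∀ x k → k ∈ K → ¬ (k ≈ e) → m ≤ dist x (act k x)

Conjugate : ∀ {n} → Subgroup n → Subgroup n → Set
Conjugate K L = ∃ λ g → ∀ h → (h ∈ L → (g · h) · (g ⁻¹) ∈ K)
                                × ((g · h) · (g ⁻¹) ∈ K → h ∈ L)

InNormalizer : ∀ {n} → Subgroup n → Aut n → Set
InNormalizer K g = ∀ h → (h ∈ K → ((g ⁻¹) · h) · g ∈ K)
                        × (((g ⁻¹) · h) · g ∈ K → h ∈ K)

-- normal quotient (Q_n)_K : vertices are K-orbits; we represent an orbit by
-- any of its elements, with x, y representing the same orbit iff SameOrbit
SameOrbit : ∀ {n} → Subgroup n → V n → V n → Set
SameOrbit K x y = ∃ λ k → k ∈ K × act k x ≡ y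

QAdj : ∀ {n} → Subgroup n → V n → V n → Set
QAdj K x y = ¬ SameOrbit K x y
           × ∃ λ x′ → ∃ λ y′ → SameOrbit K x x′ × SameOrbit K y y′ × Adj x′ y′

-- graph isomorphism (Q_n)_K ≅ (Q_n)_L, given by maps on representatives
-- that are well defined on orbits, mutually inverse on orbits, and
-- preserve and reflect adjacency
record QIso {n} (K L : Subgroup n) : Set where
  field
    to      : V n → V n
    from    : V n → V n
    to-wd   : ∀ {x y} → SameOrbit K x y → SameOrbit L (to x) (to y)
    from-wd : ∀ {x y} → SameOrbit L x y → SameOrbit K (from x) (from y)
    to-from : ∀ y → SameOrbit L (to (from y)) y
    from-to : ∀ x → SameOrbit K (from (to x)) x
    adj-to  : ∀ {x y} → QAdj K x y → QAdj L (to x) (to y)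
    adj-from : ∀ {x y} → QAdj L (to x) (to y) → QAdj K x y
open QIso public

Induces : ∀ {n} (K : Subgroup n) → Aut n → QIso K K → Set
Induces K g φ = ∀ x → SameOrbit K (to φ x) (act g x)

-- If d_K ≥ 5, two distinct vertices at distance at most 4 never share a K-orbit.
-- Hence the quotient map Q_n → (Q_n)_K is injective on unit balls, and in (Q_n)_K
-- the orbits of z ⊕ eᵢ and z ⊕ eⱼ have no common neighbours besides the orbits of z
-- and z ⊕ eᵢ ⊕ eⱼ.  An isomorphism (Q_n)_L → (Q_n)_K (which also forces the first
-- property on L) therefore induces a permutation of the n directions at 𝟎; with the
-- image of 𝟎 this defines an automorphism g of Q_n, and the rigidity of the squares
-- propagates agreement of g with the isomorphism from one unit ball to the next.
-- Finally an automorphism carrying orbits to orbits conjugates the groups, because an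
-- automorphism fixing every orbit of a group that is injective on unit balls lies in it.

module Submission where

open import Defs
open import Data.Nat using (ℕ; zero; suc; _+_; _≤_; z≤n; s≤s)
import Data.Nat.Properties as ℕ
open import Data.Bool using (true; false; _xor_; if_then_else_)
import Data.Bool.Properties as Bool
open import Data.Fin using (Fin; zero; suc; punchOut)
import Data.Fin.Properties as Fin
open import Data.Vec using ([]; _∷_; lookup; replicate; foldr)
import Data.Vec.Properties as Vec
open import Data.List using (List; []; _∷_; map)
open import Data.Fin.Permutation
  using (Permutation′; permutation; _⟨$⟩ʳ_; _⟨$⟩ˡ_; _∘ₚ_; flip; inverseˡ; inverseʳ)
open import Data.Product using (Σ; _×_; _,_; ∃; proj₁; proj₂)
open import Data.Sum using (_⊎_; inj₁; inj₂; [_,_]′)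
open import Data.Empty using (⊥-elim)
open import Function using (_∘_)
open import Function.Definitions using (Injective)
open import Relation.Binary.PropositionalEquality
open import Relation.Nullary using (¬_; yes; no)
open import Function.Bundles using (_⇔_; mk⇔)
open import Relation.Binary.Bundles using (Setoid)
import Relation.Binary.Reasoning.Setoid as ≈-Reasoning

private variable
  n : ℕ
  M N : Subgroup n
  g : Aut n

𝟎 : V n
𝟎 {n} = replicate n false

unit : Fin n → V n
unit zero    = true ∷ 𝟎
unit (suc i) = false ∷ unit i

⊕-assoc : (x y z : V n) → (x ⊕ y) ⊕ z ≡ x ⊕ (y ⊕ z)
⊕-assoc = Vec.zipWith-assoc Bool.xor-assoc

⊕-comm : (x y : V n) → x ⊕ y ≡ y ⊕ x
⊕-comm = Vec.zipWith-comm Bool.xor-comm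

⊕-identityˡ : (x : V n) → 𝟎 ⊕ x ≡ x
⊕-identityˡ = Vec.zipWith-identityˡ Bool.xor-identityˡ

⊕-identityʳ : (x : V n) → x ⊕ 𝟎 ≡ x
⊕-identityʳ = Vec.zipWith-identityʳ Bool.xor-identityʳ

⊕-self : (x : V n) → x ⊕ x ≡ 𝟎
⊕-self []      = refl
⊕-self (b ∷ x) = cong₂ _∷_ (Bool.xor-same b) (⊕-self x)

⊕-cancelˡ : (x y : V n) → x ⊕ (x ⊕ y) ≡ y
⊕-cancelˡ x y = begin
  x ⊕ (x ⊕ y) ≡⟨ ⊕-assoc x x y ⟨
  (x ⊕ x) ⊕ y ≡⟨ cong (_⊕ y) (⊕-self x) ⟩
  𝟎 ⊕ y       ≡⟨ ⊕-identityˡ y ⟩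
  y           ∎
  where open ≡-Reasoning

⊕-cancelʳ : (x y : V n) → (x ⊕ y) ⊕ y ≡ x
⊕-cancelʳ x y = trans (⊕-comm (x ⊕ y) y) (trans (cong (y ⊕_) (⊕-comm x y)) (⊕-cancelˡ y x))

⊕-injectiveʳ : (x : V n) {y z : V n} → x ⊕ y ≡ x ⊕ z → y ≡ z
⊕-injectiveʳ x {y} {z} eq = trans (sym (⊕-cancelˡ x y)) (trans (cong (x ⊕_) eq) (⊕-cancelˡ x z))

⊕-swapʳ : (x y z : V n) → (x ⊕ y) ⊕ z ≡ (x ⊕ z) ⊕ y
⊕-swapʳ x y z = trans (⊕-assoc x y z) (trans (cong (x ⊕_) (⊕-comm y z)) (sym (⊕-assoc x z y)))

lookup-⊕ : ∀ (x y : V n) i → lookup (x ⊕ y) i ≡ lookup x i xor lookup y i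
lookup-⊕ x y i = Vec.lookup-zipWith _xor_ i x y

≡-fromLookup : {x y : V n} → (∀ i → lookup x i ≡ lookup y i) → x ≡ y
≡-fromLookup {x = x} {y} p =
  trans (sym (Vec.tabulate∘lookup x)) (trans (Vec.tabulate-cong p) (Vec.tabulate∘lookup y))

lookup-unit-≡ : (i : Fin n) → lookup (unit i) i ≡ true
lookup-unit-≡ zero    = refl
lookup-unit-≡ (suc i) = lookup-unit-≡ i

lookup-unit-≢ : {i j : Fin n} → i ≢ j → lookup (unit i) j ≡ false
lookup-unit-≢ {i = zero}  {zero}  i≢j = ⊥-elim (i≢j refl)
lookup-unit-≢ {i = zero}  {suc j} _   = Vec.lookup-replicate j false
lookup-unit-≢ {i = suc i} {zero}  _   = refl
lookup-unit-≢ {i = suc i} {suc j} i≢j = lookup-unit-≢ (i≢j ∘ cong suc)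

lookup-unit-true : {i j : Fin n} → lookup (unit i) j ≡ true → i ≡ j
lookup-unit-true {i = i} {j} eq with i Fin.≟ j
... | yes i≡j = i≡j
... | no  i≢j with () ← trans (sym (lookup-unit-≢ i≢j)) eq

unit-injective : {i j : Fin n} → unit i ≡ unit j → i ≡ j
unit-injective {i = zero}  {zero}  _  = refl
unit-injective {i = suc i} {suc j} eq = cong suc (unit-injective (Vec.∷-injectiveʳ eq))

unit≢𝟎 : (i : Fin n) → unit i ≢ 𝟎
unit≢𝟎 (suc i) eq = unit≢𝟎 i (Vec.∷-injectiveʳ eq)

unit-pair : {i j p q : Fin n} → i ≢ j →
            unit i ⊕ unit p ≡ unit j ⊕ unit q → p ≡ i ⊎ p ≡ j
unit-pair {i = i} {j} {p} {q} i≢j eq with p Fin.≟ i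
... | yes p≡i = inj₁ p≡i
... | no  p≢i = inj₂ (lookup-unit-true (begin
    lookup (unit p) j                             ≡⟨ cong (_xor lookup (unit p) j) (lookup-unit-≢ i≢j) ⟨
    lookup (unit i) j xor lookup (unit p) j       ≡⟨ coordinate j ⟩
    lookup (unit j) j xor lookup (unit q) j       ≡⟨ cong₂ _xor_ (lookup-unit-≡ j) (lookup-unit-≢ q≢j) ⟩
    true                                          ∎))
  where
  open ≡-Reasoning
  coordinate : ∀ k → lookup (unit i) k xor lookup (unit p) k ≡ lookup (unit j) k xor lookup (unit q) k
  coordinate k = trans (sym (lookup-⊕ (unit i) (unit p) k)) (trans (cong (λ v → lookup v k) eq) (lookup-⊕ (unit j) (unit q) k))
  q≡i : q ≡ i
  q≡i = lookup-unit-true (begin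
    lookup (unit q) i                        ≡⟨ cong (_xor lookup (unit q) i) (lookup-unit-≢ (i≢j ∘ sym)) ⟨
    lookup (unit j) i xor lookup (unit q) i  ≡⟨ coordinate i ⟨
    lookup (unit i) i xor lookup (unit p) i  ≡⟨ cong₂ _xor_ (lookup-unit-≡ i) (lookup-unit-≢ p≢i) ⟩
    true                                     ∎)
  q≢j : q ≢ j
  q≢j q≡j = i≢j (trans (sym q≡i) q≡j)

-- Chosen so that  dist x y  is definitionally  weight (x ⊕ y).
weight : V n → ℕ
weight = foldr (λ _ → ℕ) (λ b k → (if b then 1 else 0) + k) 0

dist-⊕ : (x a : V n) → dist x (x ⊕ a) ≡ weight a
dist-⊕ x a = cong weight (⊕-cancelˡ x a)

weight-𝟎 : ∀ n → weight (𝟎 {n}) ≡ 0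
weight-𝟎 zero    = refl
weight-𝟎 (suc n) = weight-𝟎 n

weight-unit : (i : Fin n) → weight (unit i) ≡ 1
weight-unit {suc n} zero = cong suc (weight-𝟎 n)
weight-unit (suc i)      = weight-unit i

weight-⊕ : (x y : V n) → weight (x ⊕ y) ≤ weight x + weight y
weight-⊕ []         []          = z≤n
weight-⊕ (true ∷ x)  (true ∷ y)  = ℕ.≤-trans (weight-⊕ x y) (ℕ.+-mono-≤ (ℕ.n≤1+n _) (ℕ.n≤1+n _))
weight-⊕ (true ∷ x)  (false ∷ y) = s≤s (weight-⊕ x y)
weight-⊕ (false ∷ x) (true ∷ y)  = ℕ.≤-trans (s≤s (weight-⊕ x y)) (ℕ.≤-reflexive (sym (ℕ.+-suc _ _)))
weight-⊕ (false ∷ x) (false ∷ y) = weight-⊕ x y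

weight≡0⇒𝟎 : (x : V n) → weight x ≡ 0 → x ≡ 𝟎
weight≡0⇒𝟎 []          _  = refl
weight≡0⇒𝟎 (false ∷ x) eq = cong (false ∷_) (weight≡0⇒𝟎 x eq)

weight≡1⇒unit : (x : V n) → weight x ≡ 1 → ∃ λ i → x ≡ unit i
weight≡1⇒unit (true ∷ x)  eq = zero , cong (true ∷_) (weight≡0⇒𝟎 x (ℕ.suc-injective eq))
weight≡1⇒unit (false ∷ x) eq with i , x≡eᵢ ← weight≡1⇒unit x eq = suc i , cong (false ∷_) x≡eᵢ

dist-sym : (x y : V n) → dist x y ≡ dist y x
dist-sym x y = cong weight (⊕-comm x y)

dist-triangle : (x y z : V n) → dist x z ≤ dist x y + dist y z
dist-triangle x y z = ℕ.≤-trans (ℕ.≤-reflexive (cong weight x⊕z≡)) (weight-⊕ (x ⊕ y) (y ⊕ z))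
  where
  x⊕z≡ : x ⊕ z ≡ (x ⊕ y) ⊕ (y ⊕ z)
  x⊕z≡ = sym (trans (⊕-assoc x y (y ⊕ z)) (cong (x ⊕_) (⊕-cancelˡ y z)))

dist-⊕unit : ∀ (x : V n) i → dist x (x ⊕ unit i) ≡ 1
dist-⊕unit x i = trans (dist-⊕ x (unit i)) (weight-unit i)

dist-⊕unit₂ : ∀ (x : V n) i j → dist x ((x ⊕ unit i) ⊕ unit j) ≤ 2
dist-⊕unit₂ x i j = begin
  dist x ((x ⊕ unit i) ⊕ unit j) ≡⟨ cong (dist x) (⊕-assoc x (unit i) (unit j)) ⟩
  dist x (x ⊕ (unit i ⊕ unit j)) ≡⟨ dist-⊕ x (unit i ⊕ unit j) ⟩
  weight (unit i ⊕ unit j)       ≤⟨ weight-⊕ (unit i) (unit j) ⟩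
  weight (unit i) + weight (unit j) ≡⟨ cong₂ _+_ (weight-unit i) (weight-unit j) ⟩
  2                              ∎
  where open ℕ.≤-Reasoning

Adj-sym : {x y : V n} → Adj x y → Adj y x
Adj-sym {x = x} {y} a = trans (dist-sym y x) a

Adj-⊕unit : ∀ (x : V n) i → Adj x (x ⊕ unit i)
Adj-⊕unit = dist-⊕unit

Adj⇒⊕unit : {x y : V n} → Adj x y → ∃ λ i → y ≡ x ⊕ unit i
Adj⇒⊕unit {x = x} {y} a with i , x⊕y≡eᵢ ← weight≡1⇒unit (x ⊕ y) a
  = i , trans (sym (⊕-cancelˡ x y)) (cong (x ⊕_) x⊕y≡eᵢ)

lookup-permute : ∀ (σ : Permutation′ n) x j → lookup (permute σ x) j ≡ lookup x (σ ⟨$⟩ˡ j)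
lookup-permute σ x j = Vec.lookup∘tabulate _ j

permute-⊕ : ∀ (σ : Permutation′ n) x y → permute σ (x ⊕ y) ≡ permute σ x ⊕ permute σ y
permute-⊕ σ x y = ≡-fromLookup λ j → begin
  lookup (permute σ (x ⊕ y)) j                           ≡⟨ lookup-permute σ (x ⊕ y) j ⟩
  lookup (x ⊕ y) (σ ⟨$⟩ˡ j)                               ≡⟨ lookup-⊕ x y _ ⟩
  lookup x (σ ⟨$⟩ˡ j) xor lookup y (σ ⟨$⟩ˡ j)
    ≡⟨ cong₂ _xor_ (lookup-permute σ x j) (lookup-permute σ y j) ⟨
  lookup (permute σ x) j xor lookup (permute σ y) j       ≡⟨ lookup-⊕ (permute σ x) (permute σ y) j ⟨
  lookup (permute σ x ⊕ permute σ y) j                    ∎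
  where open ≡-Reasoning

permute-𝟎 : (σ : Permutation′ n) → permute σ 𝟎 ≡ 𝟎
permute-𝟎 σ = ≡-fromLookup λ j →
  trans (lookup-permute σ 𝟎 j) (trans (Vec.lookup-replicate (σ ⟨$⟩ˡ j) false) (sym (Vec.lookup-replicate j false)))

permute-unit : ∀ (σ : Permutation′ n) i → permute σ (unit i) ≡ unit (σ ⟨$⟩ʳ i)
permute-unit σ i = ≡-fromLookup λ j → trans (lookup-permute σ (unit i) j) (coordinate j)
  where
  coordinate : ∀ j → lookup (unit i) (σ ⟨$⟩ˡ j) ≡ lookup (unit (σ ⟨$⟩ʳ i)) j
  coordinate j with σ ⟨$⟩ʳ i Fin.≟ j
  ... | yes refl = trans (cong (lookup (unit i)) (inverseˡ σ)) (trans (lookup-unit-≡ i) (sym (lookup-unit-≡ (σ ⟨$⟩ʳ i))))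
  ... | no  σi≢j = trans (lookup-unit-≢ (λ i≡σ⁻¹j → σi≢j (trans (cong (σ ⟨$⟩ʳ_) i≡σ⁻¹j) (inverseʳ σ))))
                         (sym (lookup-unit-≢ σi≢j))

permute-∘ : ∀ (σ τ : Permutation′ n) x → permute (σ ∘ₚ τ) x ≡ permute τ (permute σ x)
permute-∘ σ τ x = ≡-fromLookup λ j →
  trans (lookup-permute (σ ∘ₚ τ) x j) (sym (trans (lookup-permute τ (permute σ x) j) (lookup-permute σ x _)))

permute-flipˡ : ∀ (σ : Permutation′ n) x → permute (flip σ) (permute σ x) ≡ x
permute-flipˡ σ x = ≡-fromLookup λ j →
  trans (lookup-permute (flip σ) (permute σ x) j) (trans (lookup-permute σ x _) (cong (lookup x) (inverseˡ σ)))

permute-flipʳ : ∀ (σ : Permutation′ n) x → permute σ (permute (flip σ) x) ≡ x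
permute-flipʳ σ x = ≡-fromLookup λ j →
  trans (lookup-permute σ (permute (flip σ) x) j) (trans (lookup-permute (flip σ) x _) (cong (lookup x) (inverseʳ σ)))

permute-cong : {σ τ : Permutation′ n} → (∀ i → σ ⟨$⟩ʳ i ≡ τ ⟨$⟩ʳ i) → ∀ x → permute σ x ≡ permute τ x
permute-cong {σ = σ} {τ} σ≗τ x = ≡-fromLookup λ j →
  trans (lookup-permute σ x j) (trans (cong (lookup x) (σ⁻¹≗τ⁻¹ j)) (sym (lookup-permute τ x j)))
  where
  σ⁻¹≗τ⁻¹ : ∀ j → σ ⟨$⟩ˡ j ≡ τ ⟨$⟩ˡ j
  σ⁻¹≗τ⁻¹ j = trans (cong (σ ⟨$⟩ˡ_) (sym (trans (σ≗τ (τ ⟨$⟩ˡ j)) (inverseʳ τ)))) (inverseˡ σ)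

act-· : ∀ (g h : Aut n) x → act (g · h) x ≡ act h (act g x)
act-· (σ , t) (τ , u) x = begin
  permute (σ ∘ₚ τ) x ⊕ (permute τ t ⊕ u)           ≡⟨ cong (_⊕ (permute τ t ⊕ u)) (permute-∘ σ τ x) ⟩
  permute τ (permute σ x) ⊕ (permute τ t ⊕ u)      ≡⟨ ⊕-assoc _ _ u ⟨
  (permute τ (permute σ x) ⊕ permute τ t) ⊕ u      ≡⟨ cong (_⊕ u) (permute-⊕ τ (permute σ x) t) ⟨
  permute τ (permute σ x ⊕ t) ⊕ u                  ∎
  where open ≡-Reasoning

act-e : (x : V n) → act e x ≡ x
act-e x = trans (⊕-identityʳ _) (Vec.tabulate∘lookup x)

act-⁻¹ˡ : ∀ (g : Aut n) x → act (g ⁻¹) (act g x) ≡ x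
act-⁻¹ˡ (σ , t) x = begin
  permute σ′ (permute σ x ⊕ t) ⊕ permute σ′ t               ≡⟨ cong (_⊕ permute σ′ t) (permute-⊕ σ′ (permute σ x) t) ⟩
  (permute σ′ (permute σ x) ⊕ permute σ′ t) ⊕ permute σ′ t  ≡⟨ ⊕-cancelʳ _ _ ⟩
  permute σ′ (permute σ x)                                  ≡⟨ permute-flipˡ σ x ⟩
  x                                                         ∎
  where
  open ≡-Reasoning
  σ′ = flip σ

act-⁻¹ʳ : ∀ (g : Aut n) x → act g (act (g ⁻¹) x) ≡ x
act-⁻¹ʳ (σ , t) x = begin
  permute σ (permute σ′ x ⊕ permute σ′ t) ⊕ t                ≡⟨ cong (_⊕ t) (permute-⊕ σ (permute σ′ x) (permute σ′ t)) ⟩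
  (permute σ (permute σ′ x) ⊕ permute σ (permute σ′ t)) ⊕ t  ≡⟨ cong (λ z → (permute σ (permute σ′ x) ⊕ z) ⊕ t) (permute-flipʳ σ t) ⟩
  (permute σ (permute σ′ x) ⊕ t) ⊕ t                         ≡⟨ ⊕-cancelʳ _ t ⟩
  permute σ (permute σ′ x)                                   ≡⟨ permute-flipʳ σ x ⟩
  x                                                          ∎
  where
  open ≡-Reasoning
  σ′ = flip σ

act-⁻¹-involutive : ∀ (g : Aut n) x → act ((g ⁻¹) ⁻¹) x ≡ act g x
act-⁻¹-involutive g x = trans (cong (act ((g ⁻¹) ⁻¹)) (sym (act-⁻¹ˡ g x))) (act-⁻¹ˡ (g ⁻¹) (act g x))

act-conj : ∀ (g h : Aut n) x → act (((g ⁻¹) · h) · g) x ≡ act g (act h (act (g ⁻¹) x))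
act-conj g h x = trans (act-· ((g ⁻¹) · h) g x) (cong (act g) (act-· (g ⁻¹) h x))

act-conj-conj⁻¹ : ∀ (g h : Aut n) x →
  act (((g ⁻¹) · ((((g ⁻¹) ⁻¹) · h) · (g ⁻¹))) · g) x ≡ act h x
act-conj-conj⁻¹ g h x = begin
  act (((g ⁻¹) · h′) · g) x                                   ≡⟨ act-conj g h′ x ⟩
  act g (act h′ (act (g ⁻¹) x))                               ≡⟨ cong (act g) (act-conj (g ⁻¹) h (act (g ⁻¹) x)) ⟩
  act g (act (g ⁻¹) (act h (act ((g ⁻¹) ⁻¹) (act (g ⁻¹) x)))) ≡⟨ act-⁻¹ʳ g _ ⟩
  act h (act ((g ⁻¹) ⁻¹) (act (g ⁻¹) x))                      ≡⟨ cong (act h) (act-⁻¹ˡ (g ⁻¹) x) ⟩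
  act h x                                                     ∎
  where
  open ≡-Reasoning
  h′ = (((g ⁻¹) ⁻¹) · h) · (g ⁻¹)

act-cong : {g h : Aut n} → g ≈ h → ∀ x → act g x ≡ act h x
act-cong {g = σ , t} {τ , u} (σ≗τ , t≡u) x = cong₂ _⊕_ (permute-cong {σ = σ} {τ} σ≗τ x) t≡u

act-𝟎 : (g : Aut n) → act g 𝟎 ≡ proj₂ g
act-𝟎 (σ , t) = trans (cong (_⊕ t) (permute-𝟎 σ)) (⊕-identityˡ t)

act-⊕unit : ∀ (g : Aut n) x i → act g (x ⊕ unit i) ≡ act g x ⊕ unit (proj₁ g ⟨$⟩ʳ i)
act-⊕unit (σ , t) x i = begin
  permute σ (x ⊕ unit i) ⊕ t              ≡⟨ cong (_⊕ t) (permute-⊕ σ x (unit i)) ⟩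
  (permute σ x ⊕ permute σ (unit i)) ⊕ t  ≡⟨ cong (λ z → (permute σ x ⊕ z) ⊕ t) (permute-unit σ i) ⟩
  (permute σ x ⊕ unit (σ ⟨$⟩ʳ i)) ⊕ t     ≡⟨ ⊕-swapʳ _ _ t ⟩
  (permute σ x ⊕ t) ⊕ unit (σ ⟨$⟩ʳ i)     ∎
  where open ≡-Reasoning

-- An automorphism is determined by its images of 𝟎 and of the unit vectors.
act-injective : {g h : Aut n} → (∀ x → act g x ≡ act h x) → g ≈ h
act-injective {g = g@(σ , t)} {h@(τ , u)} g≗h = σ≗τ , t≡u
  where
  t≡u : t ≡ u
  t≡u = trans (sym (act-𝟎 g)) (trans (g≗h 𝟎) (act-𝟎 h))
  σ≗τ : ∀ i → σ ⟨$⟩ʳ i ≡ τ ⟨$⟩ʳ i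
  σ≗τ i = unit-injective (⊕-injectiveʳ t (begin
    t ⊕ unit (σ ⟨$⟩ʳ i)           ≡⟨ cong (_⊕ unit (σ ⟨$⟩ʳ i)) (act-𝟎 g) ⟨
    act g 𝟎 ⊕ unit (σ ⟨$⟩ʳ i)     ≡⟨ act-⊕unit g 𝟎 i ⟨
    act g (𝟎 ⊕ unit i)            ≡⟨ g≗h (𝟎 ⊕ unit i) ⟩
    act h (𝟎 ⊕ unit i)            ≡⟨ act-⊕unit h 𝟎 i ⟩
    act h 𝟎 ⊕ unit (τ ⟨$⟩ʳ i)     ≡⟨ cong (_⊕ unit (τ ⟨$⟩ʳ i)) (trans (act-𝟎 h) (sym t≡u)) ⟩
    t ⊕ unit (τ ⟨$⟩ʳ i)           ∎))
    where open ≡-Reasoning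

∈-resp-act : (M : Subgroup n) {g h : Aut n} → (∀ x → act g x ≡ act h x) → g ∈ M → h ∈ M
∈-resp-act M {g} {h} g≗h = ∈-resp M (act-injective {g = g} {h} g≗h)

Adj-act : (g : Aut n) {x y : V n} → Adj x y → Adj (act g x) (act g y)
Adj-act g {x} {y} a with i , refl ← Adj⇒⊕unit {x = x} {y} a =
  subst (Adj (act g x)) (sym (act-⊕unit g x i)) (Adj-⊕unit (act g x) _)

module _ {n : ℕ} (M : Subgroup n) where

  orbit-refl : ∀ x → SameOrbit M x x
  orbit-refl x = e , e-∈ M , act-e x

  orbit-sym : ∀ {x y} → SameOrbit M x y → SameOrbit M y x
  orbit-sym {x} (k , k∈M , refl) = k ⁻¹ , ⁻¹-∈ M k∈M , act-⁻¹ˡ k x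

  orbit-trans : ∀ {x y z} → SameOrbit M x y → SameOrbit M y z → SameOrbit M x z
  orbit-trans {x} (k , k∈M , refl) (k′ , k′∈M , refl) = k · k′ , ·-∈ M k∈M k′∈M , act-· k k′ x

  orbit-act : ∀ {k} x → k ∈ M → SameOrbit M x (act k x)
  orbit-act {k} x k∈M = k , k∈M , refl

  orbitSetoid : Setoid _ _
  orbitSetoid = record
    { Carrier       = V n
    ; _≈_           = SameOrbit M
    ; isEquivalence = record
      { refl  = orbit-refl _
      ; sym   = λ {x} {y} → orbit-sym {x} {y}
      ; trans = λ {x} {y} {z} → orbit-trans {x} {y} {z}
      }
    }

  ≡⇒orbit : ∀ {x y} → x ≡ y → SameOrbit M x y
  ≡⇒orbit refl = orbit-refl _

  QAdj-resp : ∀ {x x′ y y′} → SameOrbit M x x′ → SameOrbit M y y′ → QAdj M x y → QAdj M x′ y′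
  QAdj-resp {x} {x′} {y} {y′} x~x′ y~y′ (x≁y , u , v , x~u , y~v , u-v) =
    (λ x′~y′ → x≁y (orbit-trans {x} {x′} x~x′ (orbit-trans {x′} {y′} x′~y′ (orbit-sym {y} y~y′)))) ,
    u , v , orbit-trans {x′} {x} (orbit-sym {x} x~x′) x~u , orbit-trans {y′} {y} (orbit-sym {y} y~y′) y~v , u-v

  QAdj-sym : ∀ {x y} → QAdj M x y → QAdj M y x
  QAdj-sym {x} {y} (x≁y , u , v , x~u , y~v , u-v) = x≁y ∘ orbit-sym {y} {x} , v , u , y~v , x~u , Adj-sym {x = u} {v} u-v

  QAdj⇒orbit-⊕unit : ∀ {y a} → QAdj M y a → ∃ λ i → SameOrbit M y (a ⊕ unit i)
  QAdj⇒orbit-⊕unit {y} {a} (_ , u , v , y~u , (k , k∈M , refl) , u-v)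
    with i , refl ← Adj⇒⊕unit {x = v} {u} (Adj-sym {x = u} {v} u-v)
    = proj₁ (k ⁻¹) ⟨$⟩ʳ i , (begin
      y                                     ≈⟨ y~u ⟩
      u                                     ≈⟨ orbit-act u (⁻¹-∈ M k∈M) ⟩
      act (k ⁻¹) u                          ≡⟨ k⁻¹u≡ ⟩
      a ⊕ unit (proj₁ (k ⁻¹) ⟨$⟩ʳ i)        ∎)
    where
    open ≈-Reasoning orbitSetoid
    k⁻¹u≡ : act (k ⁻¹) (act k a ⊕ unit i) ≡ a ⊕ unit (proj₁ (k ⁻¹) ⟨$⟩ʳ i)
    k⁻¹u≡ = trans (act-⊕unit (k ⁻¹) (act k a) i) (cong (_⊕ unit _) (act-⁻¹ˡ k a))

-- Consequences of d_K ≥ 5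

record LocallyInjective {n} (M : Subgroup n) : Set where
  field
    ≁-⊕unit  : ∀ x i → ¬ SameOrbit M x (x ⊕ unit i)
    ≁-⊕unit₂ : ∀ x {i j} → i ≢ j → ¬ SameOrbit M (x ⊕ unit i) (x ⊕ unit j)

RigidSquares : Subgroup n → Set
RigidSquares {n} M = ∀ z {i j : Fin n} → i ≢ j → ∀ {y} →
  QAdj M y (z ⊕ unit i) → QAdj M y (z ⊕ unit j) →
  SameOrbit M y z ⊎ SameOrbit M y ((z ⊕ unit i) ⊕ unit j)

module _ {n} {M : Subgroup n} (d≥5 : dK≥ M 5) where

  orbit-close⇒≡ : ∀ {x y} → SameOrbit M x y → dist x y ≤ 4 → x ≡ y
  orbit-close⇒≡ {x} (k , k∈M , refl) d≤4 with Vec.≡-dec Bool._≟_ x (act k x)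
  ... | yes x≡kx = x≡kx
  ... | no  x≢kx = ⊥-elim (ℕ.≤⇒≯ d≤4 (d≥5 x k k∈M k≉e))
    where
    k≉e : ¬ k ≈ e
    k≉e k≈e = x≢kx (sym (trans (act-cong {g = k} {e} k≈e x) (act-e x)))

  dK≥5⇒locallyInjective : LocallyInjective M
  dK≥5⇒locallyInjective = record { ≁-⊕unit = ≁-⊕unit ; ≁-⊕unit₂ = ≁-⊕unit₂ }
    where
    ≁-⊕unit : ∀ x i → ¬ SameOrbit M x (x ⊕ unit i)
    ≁-⊕unit x i x~x⊕eᵢ = unit≢𝟎 i (sym (⊕-injectiveʳ x
      (trans (⊕-identityʳ x) (orbit-close⇒≡ x~x⊕eᵢ (ℕ.≤-trans (ℕ.≤-reflexive (dist-⊕unit x i)) (s≤s z≤n))))))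
    ≁-⊕unit₂ : ∀ x {i j} → i ≢ j → ¬ SameOrbit M (x ⊕ unit i) (x ⊕ unit j)
    ≁-⊕unit₂ x {i} {j} i≢j x⊕eᵢ~x⊕eⱼ =
      i≢j (unit-injective (⊕-injectiveʳ x (orbit-close⇒≡ x⊕eᵢ~x⊕eⱼ d≤4)))
      where
      d≤4 : dist (x ⊕ unit i) (x ⊕ unit j) ≤ 4
      d≤4 = begin
        dist (x ⊕ unit i) (x ⊕ unit j)                  ≤⟨ dist-triangle (x ⊕ unit i) x (x ⊕ unit j) ⟩
        dist (x ⊕ unit i) x + dist x (x ⊕ unit j)
          ≡⟨ cong₂ _+_ (trans (dist-sym (x ⊕ unit i) x) (dist-⊕unit x i)) (dist-⊕unit x j) ⟩
        2                                               ≤⟨ s≤s (s≤s z≤n) ⟩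
        4                                               ∎
        where open ℕ.≤-Reasoning

  dK≥5⇒rigidSquares : RigidSquares M
  dK≥5⇒rigidSquares z {i} {j} i≢j {y} y-z⊕eᵢ y-z⊕eⱼ
    with p , y~u ← QAdj⇒orbit-⊕unit M {y} {z ⊕ unit i} y-z⊕eᵢ
       | q , y~w ← QAdj⇒orbit-⊕unit M {y} {z ⊕ unit j} y-z⊕eⱼ
    with unit-pair i≢j (⊕-injectiveʳ z (trans (sym (⊕-assoc z (unit i) (unit p)))
           (trans (orbit-close⇒≡ (orbit-trans M {u} {y} (orbit-sym M {y} {u} y~u) y~w) d≤4) (⊕-assoc z (unit j) (unit q)))))
    where
    u = (z ⊕ unit i) ⊕ unit p
    w = (z ⊕ unit j) ⊕ unit q
    d≤4 : dist u w ≤ 4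
    d≤4 = ℕ.≤-trans (dist-triangle u z w)
            (ℕ.+-mono-≤ (ℕ.≤-trans (ℕ.≤-reflexive (dist-sym u z)) (dist-⊕unit₂ z i p)) (dist-⊕unit₂ z j q))
  ... | inj₁ refl = inj₁ (orbit-trans M {y} y~u (≡⇒orbit M (⊕-cancelʳ z (unit i))))
  ... | inj₂ refl = inj₂ y~u

module _ {n} {M : Subgroup n} (locM : LocallyInjective M) where
  open LocallyInjective locM

  -- An automorphism fixing every M-orbit agrees with some k⁻¹ (k ∈ M) at 𝟎;
  -- then g · k fixes 𝟎 and every orbit, so local injectivity forces it to be e.
  orbitwise-trivial⇒∈ : ∀ {g} → (∀ x → SameOrbit M (act g x) x) → g ∈ M
  orbitwise-trivial⇒∈ {g} g~id with k , k∈M , kg𝟎≡𝟎 ← g~id 𝟎 =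
    ∈-resp-act M {k ⁻¹} {g} k⁻¹≗g (⁻¹-∈ M k∈M)
    where
    h = g · k
    h~id : ∀ x → SameOrbit M (act h x) x
    h~id x = begin
      act h x          ≡⟨ act-· g k x ⟩
      act k (act g x)  ≈⟨ orbit-act M (act g x) k∈M ⟨
      act g x          ≈⟨ g~id x ⟩
      x                ∎
      where open ≈-Reasoning (orbitSetoid M)
    h𝟎≡𝟎 : proj₂ h ≡ 𝟎
    h𝟎≡𝟎 = trans (sym (act-𝟎 h)) (trans (act-· g k 𝟎) kg𝟎≡𝟎)
    h-fixes-units : ∀ i → proj₁ h ⟨$⟩ʳ i ≡ i
    h-fixes-units i with proj₁ h ⟨$⟩ʳ i Fin.≟ i
    ... | yes hi≡i = hi≡i
    ... | no  hi≢i = ⊥-elim (≁-⊕unit₂ 𝟎 hi≢i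
            (orbit-trans M {𝟎 ⊕ unit (proj₁ h ⟨$⟩ʳ i)} {act h (𝟎 ⊕ unit i)} (≡⇒orbit M eᵢ≡) (h~id (𝟎 ⊕ unit i))))
      where
      eᵢ≡ : 𝟎 ⊕ unit (proj₁ h ⟨$⟩ʳ i) ≡ act h (𝟎 ⊕ unit i)
      eᵢ≡ = sym (trans (act-⊕unit h 𝟎 i) (cong (_⊕ unit _) (trans (act-𝟎 h) h𝟎≡𝟎)))
    k⁻¹≗g : ∀ x → act (k ⁻¹) x ≡ act g x
    k⁻¹≗g x = begin
      act (k ⁻¹) x
        ≡⟨ cong (act (k ⁻¹)) (trans (act-cong {g = h} {e} (h-fixes-units , h𝟎≡𝟎) x) (act-e x)) ⟨
      act (k ⁻¹) (act h x)        ≡⟨ cong (act (k ⁻¹)) (act-· g k x) ⟩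
      act (k ⁻¹) (act k (act g x)) ≡⟨ act-⁻¹ˡ k (act g x) ⟩
      act g x                     ∎
      where open ≡-Reasoning

-- M ^ g = N; the field has the shape of InNormalizer, which is the case M = N.
record ConjugatesTo {n} (M : Subgroup n) (g : Aut n) (N : Subgroup n) : Set where
  constructor conjugatesTo
  field
    conjugates : ∀ h → (h ∈ M → ((g ⁻¹) · h) · g ∈ N) × (((g ⁻¹) · h) · g ∈ N → h ∈ M)
open ConjugatesTo

ConjugatesTo-sym : ConjugatesTo M g N → ConjugatesTo N (g ⁻¹) M
ConjugatesTo-sym {M = M} {g = g} {N = N} M^g≡N = conjugatesTo conj
  where
  conj : ∀ h → (h ∈ N → (((g ⁻¹) ⁻¹) · h) · (g ⁻¹) ∈ M) × ((((g ⁻¹) ⁻¹) · h) · (g ⁻¹) ∈ M → h ∈ N)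
  conj h =
      (λ h∈N → proj₂ (conjugates M^g≡N h′) (∈-resp-act N {h} {((g ⁻¹) · h′) · g} (sym ∘ act-conj-conj⁻¹ g h) h∈N))
    , (λ h′∈M → ∈-resp-act N {((g ⁻¹) · h′) · g} {h} (act-conj-conj⁻¹ g h) (proj₁ (conjugates M^g≡N h′) h′∈M))
    where h′ = (((g ⁻¹) ⁻¹) · h) · (g ⁻¹)

orbit-transport : ConjugatesTo M g N → ∀ {x y} → SameOrbit M x y → SameOrbit N (act g x) (act g y)
orbit-transport {g = g} M^g≡N {x} (k , k∈M , refl) =
  ((g ⁻¹) · k) · g , proj₁ (conjugates M^g≡N k) k∈M ,
  trans (act-conj g k (act g x)) (cong (act g ∘ act k) (act-⁻¹ˡ g x))

orbit-reflect : ConjugatesTo M g N → ∀ {x y} → SameOrbit N (act g x) (act g y) → SameOrbit M x y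
orbit-reflect {M = M} {g = g} M^g≡N {x} {y} gx~gy =
  subst₂ (SameOrbit M) (act-⁻¹ˡ g x) (act-⁻¹ˡ g y) (orbit-transport (ConjugatesTo-sym M^g≡N) {act g x} {act g y} gx~gy)

QAdj-transport : ConjugatesTo M g N → ∀ {x y} → QAdj M x y → QAdj N (act g x) (act g y)
QAdj-transport {g = g} M^g≡N {x} {y} (x≁y , u , v , x~u , y~v , u-v) =
  x≁y ∘ orbit-reflect M^g≡N {x} {y} , act g u , act g v ,
  orbit-transport M^g≡N {x} {u} x~u , orbit-transport M^g≡N {y} {v} y~v , Adj-act g {u} {v} u-v

ConjugatesTo⇒QIso : ConjugatesTo M g N → QIso M N
ConjugatesTo⇒QIso {M = M} {g = g} {N = N} M^g≡N = record
  { to       = act g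
  ; from     = act (g ⁻¹)
  ; to-wd    = λ {x} {y} → orbit-transport M^g≡N {x} {y}
  ; from-wd  = λ {x} {y} → orbit-transport (ConjugatesTo-sym M^g≡N) {x} {y}
  ; to-from  = λ y → ≡⇒orbit N (act-⁻¹ʳ g y)
  ; from-to  = λ x → ≡⇒orbit M (act-⁻¹ˡ g x)
  ; adj-to   = λ {x} {y} → QAdj-transport M^g≡N {x} {y}
  ; adj-from = λ {x} {y} q → subst₂ (QAdj M) (act-⁻¹ˡ g x) (act-⁻¹ˡ g y)
                               (QAdj-transport (ConjugatesTo-sym M^g≡N) {act g x} {act g y} q)
  }

orbit-iso⇒ConjugatesTo : LocallyInjective M → LocallyInjective N →
  (∀ {x y} → SameOrbit M x y → SameOrbit N (act g x) (act g y)) →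
  (∀ {x y} → SameOrbit N (act g x) (act g y) → SameOrbit M x y) →
  ConjugatesTo M g N
orbit-iso⇒ConjugatesTo {M = M} {N = N} {g = g} locM locN transport reflect =
  conjugatesTo λ h → h∈M⇒h^g∈N h , h^g∈N⇒h∈M h
  where
  h∈M⇒h^g∈N : ∀ h → h ∈ M → ((g ⁻¹) · h) · g ∈ N
  h∈M⇒h^g∈N h h∈M = orbitwise-trivial⇒∈ locN λ y → begin
    act (((g ⁻¹) · h) · g) y        ≡⟨ act-conj g h y ⟩
    act g (act h (act (g ⁻¹) y))    ≈⟨ transport {act (g ⁻¹) y} (orbit-act M (act (g ⁻¹) y) h∈M) ⟨
    act g (act (g ⁻¹) y)            ≡⟨ act-⁻¹ʳ g y ⟩
    y                               ∎
    where open ≈-Reasoning (orbitSetoid N)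
  h^g∈N⇒h∈M : ∀ h → ((g ⁻¹) · h) · g ∈ N → h ∈ M
  h^g∈N⇒h∈M h h^g∈N = orbitwise-trivial⇒∈ locM λ w → reflect {act h w} {w} (begin
    act g (act h w)                         ≡⟨ cong (act g ∘ act h) (act-⁻¹ˡ g w) ⟨
    act g (act h (act (g ⁻¹) (act g w)))    ≡⟨ act-conj g h (act g w) ⟨
    act (((g ⁻¹) · h) · g) (act g w)        ≈⟨ orbit-act N (act g w) h^g∈N ⟨
    act g w                                 ∎)
    where open ≈-Reasoning (orbitSetoid N)

to-reflects : (φ : QIso M N) → ∀ {x y} → SameOrbit N (to φ x) (to φ y) → SameOrbit M x y
to-reflects {M = M} φ {x} {y} fx~fy = begin
  x                ≈⟨ from-to φ x ⟨
  from φ (to φ x)  ≈⟨ from-wd φ fx~fy ⟩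
  from φ (to φ y)  ≈⟨ from-to φ y ⟩
  y                ∎
  where open ≈-Reasoning (orbitSetoid M)

QIso-sym : QIso M N → QIso N M
QIso-sym {M = M} {N = N} φ = record
  { to       = from φ
  ; from     = to φ
  ; to-wd    = from-wd φ
  ; from-wd  = to-wd φ
  ; to-from  = from-to φ
  ; from-to  = to-from φ
  ; adj-to   = λ {x} {y} q → adj-from φ (QAdj-resp N {x} {tf x} {y} {tf y} (tf-back x) (tf-back y) q)
  ; adj-from = λ {x} {y} q → QAdj-resp N {tf x} {x} {tf y} {y} (to-from φ x) (to-from φ y) (adj-to φ q)
  }
  where
  tf : V _ → V _
  tf x = to φ (from φ x)
  tf-back : ∀ x → SameOrbit N x (tf x)
  tf-back x = orbit-sym N {tf x} {x} (to-from φ x)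

lift⇒ConjugatesTo : LocallyInjective M → LocallyInjective N → (φ : QIso M N) →
  (∀ x → SameOrbit N (to φ x) (act g x)) → ConjugatesTo M g N
lift⇒ConjugatesTo {M = M} {N = N} {g = g} locM locN φ φ~g =
  orbit-iso⇒ConjugatesTo locM locN (λ {x} {y} → transport {x} {y}) (λ {x} {y} → reflect {x} {y})
  where
  open ≈-Reasoning (orbitSetoid N)
  transport : ∀ {x y} → SameOrbit M x y → SameOrbit N (act g x) (act g y)
  transport {x} {y} x~y = begin
    act g x  ≈⟨ φ~g x ⟨
    to φ x   ≈⟨ to-wd φ x~y ⟩
    to φ y   ≈⟨ φ~g y ⟩
    act g y  ∎
  reflect : ∀ {x y} → SameOrbit N (act g x) (act g y) → SameOrbit M x y
  reflect {x} {y} gx~gy = to-reflects φ (begin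
    to φ x   ≈⟨ φ~g x ⟩
    act g x  ≈⟨ gx~gy ⟩
    act g y  ≈⟨ φ~g y ⟨
    to φ y   ∎)

Conjugate⇒ConjugatesTo : Conjugate M N → ∃ λ g → ConjugatesTo N g M
Conjugate⇒ConjugatesTo {M = M} (g , c) = g ⁻¹ , conjugatesTo λ h →
    (λ h∈N → ∈-resp-act M {(g · h) · (g ⁻¹)} (conj≗ h) (proj₁ (c h) h∈N))
  , (λ h^g∈M → proj₂ (c h) (∈-resp-act M {_} {(g · h) · (g ⁻¹)} (sym ∘ conj≗ h) h^g∈M))
  where
  conj≗ : ∀ h x → act ((g · h) · (g ⁻¹)) x ≡ act ((((g ⁻¹) ⁻¹) · h) · (g ⁻¹)) x
  conj≗ h x = begin
    act ((g · h) · (g ⁻¹)) x                 ≡⟨ act-· (g · h) (g ⁻¹) x ⟩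
    act (g ⁻¹) (act (g · h) x)               ≡⟨ cong (act (g ⁻¹)) (act-· g h x) ⟩
    act (g ⁻¹) (act h (act g x))             ≡⟨ cong (act (g ⁻¹) ∘ act h) (act-⁻¹-involutive g x) ⟨
    act (g ⁻¹) (act h (act ((g ⁻¹) ⁻¹) x))   ≡⟨ act-conj (g ⁻¹) h x ⟨
    act ((((g ⁻¹) ⁻¹) · h) · (g ⁻¹)) x       ∎
    where open ≡-Reasoning

ConjugatesTo⇒Conjugate : ConjugatesTo N g M → Conjugate M N
ConjugatesTo⇒Conjugate {N = N} {g = g} {M = M} N^g≡M = g ⁻¹ , λ h →
    (λ h∈N → ∈-resp-act M {((g ⁻¹) · h) · g} (conj≗ h) (proj₁ (conjugates N^g≡M h) h∈N))
  , (λ h^g∈M → proj₂ (conjugates N^g≡M h) (∈-resp-act M {_} {((g ⁻¹) · h) · g} (sym ∘ conj≗ h) h^g∈M))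
  where
  conj≗ : ∀ h x → act (((g ⁻¹) · h) · g) x ≡ act (((g ⁻¹) · h) · ((g ⁻¹) ⁻¹)) x
  conj≗ h x = trans (act-· ((g ⁻¹) · h) g x)
    (sym (trans (act-· ((g ⁻¹) · h) ((g ⁻¹) ⁻¹) x) (act-⁻¹-involutive g (act ((g ⁻¹) · h) x))))

-- Lifting isomorphisms of normal quotients

-- Pigeonhole: an injection missing j would induce an injection Fin (suc m) → Fin m.
injective⇒surjective : (σ : Fin n → Fin n) → Injective _≡_ _≡_ σ → ∀ j → ∃ λ i → σ i ≡ j
injective⇒surjective {suc m} σ σ-inj j with Fin.any? (λ i → σ i Fin.≟ j)
... | yes hit = hit
... | no  miss = ⊥-elim (ℕ.<-irrefl refl (Fin.injective⇒≤ {f = σ′}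
        (λ {a} {b} eq → σ-inj (Fin.punchOut-injective (j≢σ a) (j≢σ b) eq))))
  where
  j≢σ : ∀ i → j ≢ σ i
  j≢σ i j≡σi = miss (i , sym j≡σi)
  σ′ : Fin (suc m) → Fin m
  σ′ i = punchOut (j≢σ i)

injection⇒permutation : (σ : Fin n → Fin n) → Injective _≡_ _≡_ σ → Permutation′ n
injection⇒permutation σ σ-inj = permutation σ (proj₁ ∘ onto) (proj₂ ∘ onto) (λ i → σ-inj (proj₂ (onto (σ i))))
  where onto = injective⇒surjective σ σ-inj

unitSum : List (Fin n) → V n
unitSum []       = 𝟎
unitSum (i ∷ is) = unitSum is ⊕ unit i

support : V n → List (Fin n)
support []          = []
support (true ∷ x)  = zero ∷ map suc (support x)
support (false ∷ x) = map suc (support x)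

unitSum-map-suc : (is : List (Fin n)) → unitSum (map suc is) ≡ false ∷ unitSum is
unitSum-map-suc []       = refl
unitSum-map-suc (i ∷ is) = cong (_⊕ unit (suc i)) (unitSum-map-suc is)

unitSum-support : (x : V n) → unitSum (support x) ≡ x
unitSum-support []          = refl
unitSum-support (true ∷ x)  = trans (cong (_⊕ unit zero) (unitSum-map-suc (support x)))
                                    (cong (true ∷_) (trans (⊕-identityʳ _) (unitSum-support x)))
unitSum-support (false ∷ x) = trans (unitSum-map-suc (support x)) (cong (false ∷_) (unitSum-support x))

⊕unit-induction : (P : V n → Set) → P 𝟎 → (∀ x i → P x → P (x ⊕ unit i)) → ∀ x → P x
⊕unit-induction P P𝟎 step x = subst P (unitSum-support x) (go (support x))
  where
  go : ∀ is → P (unitSum is)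
  go []       = P𝟎
  go (i ∷ is) = step (unitSum is) i (go is)

module Lifting {n} {M N : Subgroup n} (locM : LocallyInjective M) (f : V n → V n)
  (f-reflects : ∀ {x y} → SameOrbit N (f x) (f y) → SameOrbit M x y)
  (f-QAdj : ∀ {x y} → QAdj M x y → QAdj N (f x) (f y)) where

  open LocallyInjective locM
  open ≈-Reasoning (orbitSetoid N)

  QAdj-f-⊕unit : ∀ x i → QAdj N (f (x ⊕ unit i)) (f x)
  QAdj-f-⊕unit x i = f-QAdj {x ⊕ unit i} {x}
    (QAdj-sym M {x} (≁-⊕unit x i , x , x ⊕ unit i , orbit-refl M x , orbit-refl M _ , Adj-⊕unit x i))

  direction-map : ∀ {x y} → SameOrbit N (f x) y →
    Σ (Fin n → Fin n) λ σ → Injective _≡_ _≡_ σ × (∀ i → SameOrbit N (f (x ⊕ unit i)) (y ⊕ unit (σ i)))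
  direction-map {x} {y} fx~y = σ , σ-injective , σ-spec
    where
    neighbour : ∀ i → ∃ λ p → SameOrbit N (f (x ⊕ unit i)) (y ⊕ unit p)
    neighbour i = QAdj⇒orbit-⊕unit N {f (x ⊕ unit i)} {y}
      (QAdj-resp N {f (x ⊕ unit i)} {f (x ⊕ unit i)} {f x} (orbit-refl N _) fx~y (QAdj-f-⊕unit x i))
    σ : Fin n → Fin n
    σ i = proj₁ (neighbour i)
    σ-spec : ∀ i → SameOrbit N (f (x ⊕ unit i)) (y ⊕ unit (σ i))
    σ-spec i = proj₂ (neighbour i)
    σ-injective : Injective _≡_ _≡_ σ
    σ-injective {i} {j} σi≡σj with i Fin.≟ j
    ... | yes i≡j = i≡j
    ... | no  i≢j = ⊥-elim (≁-⊕unit₂ x i≢j (f-reflects (begin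
      f (x ⊕ unit i)    ≈⟨ σ-spec i ⟩
      y ⊕ unit (σ i)    ≡⟨ cong (λ p → y ⊕ unit p) σi≡σj ⟩
      y ⊕ unit (σ j)    ≈⟨ σ-spec j ⟨
      f (x ⊕ unit j)    ∎)))

  surjective⇒locallyInjective : (∀ y → ∃ λ x → SameOrbit N (f x) y) → LocallyInjective N
  surjective⇒locallyInjective f-onto = record { ≁-⊕unit = ≁-⊕unitᴺ ; ≁-⊕unit₂ = ≁-⊕unit₂ᴺ }
    where
    ≁-⊕unitᴺ : ∀ y j → ¬ SameOrbit N y (y ⊕ unit j)
    ≁-⊕unitᴺ y j y~y⊕eⱼ
      with x , fx~y ← f-onto y
      with σ , σ-inj , σ-spec ← direction-map fx~y
      with i , refl ← injective⇒surjective σ σ-inj j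
      = ≁-⊕unit x i (orbit-sym M {x ⊕ unit i} {x} (f-reflects (begin
          f (x ⊕ unit i)   ≈⟨ σ-spec i ⟩
          y ⊕ unit (σ i)   ≈⟨ y~y⊕eⱼ ⟨
          y                ≈⟨ fx~y ⟨
          f x              ∎)))
    ≁-⊕unit₂ᴺ : ∀ y {j₁ j₂} → j₁ ≢ j₂ → ¬ SameOrbit N (y ⊕ unit j₁) (y ⊕ unit j₂)
    ≁-⊕unit₂ᴺ y {j₁} {j₂} j₁≢j₂ y⊕eⱼ₁~y⊕eⱼ₂
      with x , fx~y ← f-onto y
      with σ , σ-inj , σ-spec ← direction-map fx~y
      with i₁ , refl ← injective⇒surjective σ σ-inj j₁
         | i₂ , refl ← injective⇒surjective σ σ-inj j₂
      = ≁-⊕unit₂ x (j₁≢j₂ ∘ cong σ) (f-reflects (begin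
          f (x ⊕ unit i₁)   ≈⟨ σ-spec i₁ ⟩
          y ⊕ unit (σ i₁)   ≈⟨ y⊕eⱼ₁~y⊕eⱼ₂ ⟩
          y ⊕ unit (σ i₂)   ≈⟨ σ-spec i₂ ⟨
          f (x ⊕ unit i₂)   ∎))

  -- ĝ is read off at 𝟎; agreement of f with ĝ on a unit ball propagates to the
  -- neighbouring unit balls through the rigid squares.
  lift : RigidSquares N → ∃ λ ĝ → ∀ x → SameOrbit N (f x) (act ĝ x)
  lift rigid with σ , σ-inj , σ-spec ← direction-map {𝟎} (orbit-refl N (f 𝟎)) =
    ĝ , λ x → proj₁ (⊕unit-induction AgreesNear agreesNear-𝟎 agreesNear-step x)
    where
    ĝ : Aut n
    ĝ = injection⇒permutation σ σ-inj , f 𝟎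
    ĝ-⊕unit : ∀ x i → act ĝ (x ⊕ unit i) ≡ act ĝ x ⊕ unit (σ i)
    ĝ-⊕unit = act-⊕unit ĝ
    Agrees : V n → Set
    Agrees x = SameOrbit N (f x) (act ĝ x)
    AgreesNear : V n → Set
    AgreesNear x = Agrees x × ∀ i → Agrees (x ⊕ unit i)
    agreesNear-𝟎 : AgreesNear 𝟎
    agreesNear-𝟎 = ≡⇒orbit N (sym (act-𝟎 ĝ)) , λ i → begin
      f (𝟎 ⊕ unit i)           ≈⟨ σ-spec i ⟩
      f 𝟎 ⊕ unit (σ i)         ≡⟨ cong (_⊕ unit (σ i)) (act-𝟎 ĝ) ⟨
      act ĝ 𝟎 ⊕ unit (σ i)     ≡⟨ ĝ-⊕unit 𝟎 i ⟨
      act ĝ (𝟎 ⊕ unit i)       ∎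
    agreesNear-step : ∀ x j → AgreesNear x → AgreesNear (x ⊕ unit j)
    agreesNear-step x j (fx~ĝx , near) = near j , agrees
      where
      agrees : ∀ i → Agrees ((x ⊕ unit j) ⊕ unit i)
      agrees i with i Fin.≟ j
      ... | yes refl = subst Agrees (sym (⊕-cancelʳ x (unit i))) fx~ĝx
      ... | no  i≢j = [ absurd , lift-agrees ]′ (rigid (act ĝ x) (i≢j ∘ sym ∘ σ-inj) {f w} w-σj w-σi)
        where
        w = (x ⊕ unit j) ⊕ unit i
        w-σj : QAdj N (f w) (act ĝ x ⊕ unit (σ j))
        w-σj = QAdj-resp N {f w} {f w} {f (x ⊕ unit j)} (orbit-refl N _)
          (orbit-trans N {f (x ⊕ unit j)} (near j) (≡⇒orbit N (ĝ-⊕unit x j))) (QAdj-f-⊕unit (x ⊕ unit j) i)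
        w-σi : QAdj N (f w) (act ĝ x ⊕ unit (σ i))
        w-σi = QAdj-resp N {f ((x ⊕ unit i) ⊕ unit j)} {f w} {f (x ⊕ unit i)}
          (≡⇒orbit N (cong f (⊕-swapʳ x (unit i) (unit j))))
          (orbit-trans N {f (x ⊕ unit i)} (near i) (≡⇒orbit N (ĝ-⊕unit x i))) (QAdj-f-⊕unit (x ⊕ unit i) j)
        absurd : SameOrbit N (f w) (act ĝ x) → Agrees w
        absurd fw~ĝx = ⊥-elim (≁-⊕unit₂ (x ⊕ unit j) i≢j (subst (SameOrbit M w) (sym (⊕-cancelʳ x (unit j)))
          (f-reflects {w} {x} (begin
            f w       ≈⟨ fw~ĝx ⟩
            act ĝ x   ≈⟨ fx~ĝx ⟨
            f x       ∎))))
        lift-agrees : SameOrbit N (f w) ((act ĝ x ⊕ unit (σ j)) ⊕ unit (σ i)) → Agrees w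
        lift-agrees fw~ = begin
          f w                                    ≈⟨ fw~ ⟩
          (act ĝ x ⊕ unit (σ j)) ⊕ unit (σ i)    ≡⟨ cong (_⊕ unit (σ i)) (ĝ-⊕unit x j) ⟨
          act ĝ (x ⊕ unit j) ⊕ unit (σ i)        ≡⟨ ĝ-⊕unit (x ⊕ unit j) i ⟨
          act ĝ w                                ∎

locallyInjective-resp-QIso : LocallyInjective M → QIso M N → LocallyInjective N
locallyInjective-resp-QIso {M = M} {N = N} locM φ =
  Lifting.surjective⇒locallyInjective {M = M} {N} locM (to φ) (to-reflects φ) (adj-to φ) (λ y → from φ y , to-from φ y)

QIso⇒ConjugatesTo : LocallyInjective M → RigidSquares N → (φ : QIso M N) →
  ∃ λ g → ConjugatesTo M g N × (∀ x → SameOrbit N (to φ x) (act g x))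
QIso⇒ConjugatesTo {M = M} {N = N} locM rigidN φ =
  h , lift⇒ConjugatesTo {M = M} {N} {h} locM (locallyInjective-resp-QIso locM φ) φ φ~h , φ~h
  where
  lifted = Lifting.lift {M = M} {N} locM (to φ) (to-reflects φ) (adj-to φ) rigidN
  h = proj₁ lifted
  φ~h = proj₂ lifted

theorem1p4 : ∀ (n : ℕ) (K L : Subgroup n) → dK≥ K 5 →
      (QIso K L ⇔ Conjugate K L)
    × ((∀ g → InNormalizer K g → Σ (QIso K K) (Induces K g))
    × ((∀ (φ : QIso K K) → ∃ λ g → InNormalizer K g × Induces K g φ)
    × (∀ g → InNormalizer K g → ((∀ x → SameOrbit K (act g x) x) ⇔ g ∈ K))))
theorem1p4 n K L d≥5 = mk⇔ iso⇒conj conj⇒iso , normalizer⇒auto , auto⇒normalizer , kernel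
  where
  locK : LocallyInjective K
  locK = dK≥5⇒locallyInjective {M = K} d≥5
  rigidK : RigidSquares K
  rigidK = dK≥5⇒rigidSquares {M = K} d≥5

  -- Only K is known to have rigid squares, so it is φ⁻¹ : (Q_n)_L → (Q_n)_K that is lifted.
  iso⇒conj : QIso K L → Conjugate K L
  iso⇒conj φ = ConjugatesTo⇒Conjugate (proj₁ (proj₂
    (QIso⇒ConjugatesTo (locallyInjective-resp-QIso locK φ) rigidK (QIso-sym φ))))

  conj⇒iso : Conjugate K L → QIso K L
  conj⇒iso c = QIso-sym (ConjugatesTo⇒QIso (proj₂ (Conjugate⇒ConjugatesTo {M = K} {L} c)))

  normalizer⇒auto : ∀ g → InNormalizer K g → Σ (QIso K K) (Induces K g)
  normalizer⇒auto g g∈N = ConjugatesTo⇒QIso (conjugatesTo {M = K} {g} {K} g∈N) , λ x → orbit-refl K (act g x)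

  auto⇒normalizer : ∀ (φ : QIso K K) → ∃ λ g → InNormalizer K g × Induces K g φ
  auto⇒normalizer φ = let g , K^g≡K , φ~g = QIso⇒ConjugatesTo {M = K} {K} locK rigidK φ in g , conjugates K^g≡K , φ~g

  kernel : ∀ g → InNormalizer K g → ((∀ x → SameOrbit K (act g x) x) ⇔ g ∈ K)
  kernel g _ = mk⇔ (orbitwise-trivial⇒∈ locK {g}) (λ g∈K x → orbit-sym K {x} {act g x} (orbit-act K x g∈K))
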